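{- Let $T$ be a tree with burning number $b(T)=m$. Then $T$ is maximally $m$-burnable if and only if for every optimal burning sequence $(x_1,\dots,x_m)$ of $T$, every leaf of $T$ is burned in the last round (i.e. $\min_{1\le i\le m}(i+d(u,x_i))=m$ for each leaf $u$) and the associated neighbourhoods $N_{m-1}[x_1],\dots,N_0[x_m]$ are mutually non-overlapping.
   Context: All graphs are finite, simple, undirected. $d(u,v)$ is the distance and $N_k[v]=\{u: d(u,v)\le k\}$. A sequence $(x_1,\dots,x_m)$ of vertices of $G$ is a burning sequence of $G$ if $N_{m-1}[x_1]\cup\cdots\cup N_0[x_m]=V(G)$ and $d(x_i,x_j)\ge j-i$ for all $i<j$ (source $x_i$ is lit in round $i$ and fire spreads to neighbours each round; vertex $u$ becomes burned in round $\min_i(i+d(u,x_i))$). The burning number $b(G)$ is the least length of a burning sequence; $G$ is $m$-burnable if $b(G)\le m$; a burning sequence of length $b(G)$ is optimal; $N_{m-i}[x_i]$ is the neighbourhood associated to $x_i$. In a tree: a leaf has degree one, a branch vertex has degree at least three, an arm is a path from a branch vertex to a leaf with no branch vertex in between, an internal path is a path between two branch vertices with no other branch vertex in between. A tree $T$ with $b(T)=m$ is maximally $m$-burnable if every tree obtained from $T$ by inserting one new vertex into one of its arms or internal paths is not $m$-burnable. -}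

module Defs where

open import Data.Nat using (ℕ; zero; suc; _+_; _∸_; _≤_; _<_)
open import Data.Fin using (Fin; zero; suc; toℕ; fromℕ; _≟_)
open import Data.Bool using (Bool; true; false; _∧_; _∨_; not; if_then_else_)
open import Data.Maybe using (Maybe; just; nothing)
import Data.Maybe as Maybe
open import Data.List using (List; []; _∷_; _∷ʳ_; length; map; allFin)
open import Data.Nat.ListAction using (sum)
open import Data.List.Relation.Unary.Unique.Propositional using (Unique)
open import Data.Unit using (⊤)
open import Data.Product using (Σ; ∃; _×_; _,_)
open import Relation.Nullary using (¬_)
open import Relation.Nullary.Decidable using (⌊_⌋)
open import Relation.Binary.PropositionalEquality using (_≡_; _≢_)

record Graph : Set where
  field
    n   : ℕ
    adj : Fin n → Fin n → Bool
open Graph public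

Vtx : Graph → Set
Vtx G = Fin (n G)

IsSimple : Graph → Set
IsSimple G = (∀ u v → adj G u v ≡ adj G v u) × (∀ u → adj G u u ≡ false)

-- Reach G k u v  :⇔  there is a walk of length ≤ k from u to v, i.e. d(u,v) ≤ k.
data Reach (G : Graph) : ℕ → Vtx G → Vtx G → Set where
  here : ∀ {k u} → Reach G k u u
  step : ∀ {k u w v} → adj G u w ≡ true → Reach G k w v → Reach G (suc k) u v

DistGe : (G : Graph) → Vtx G → Vtx G → ℕ → Set
DistGe G u v k = ∀ l → Reach G l u v → k ≤ l

Connected : Graph → Set
Connected G = ∀ u v → ∃ λ k → Reach G k u v

Chain : (G : Graph) → Vtx G → List (Vtx G) → Set
Chain G x []       = ⊤
Chain G x (y ∷ ys) = (adj G x y ≡ true) × Chain G y ys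

-- a cycle v, w₁, …, w_k, w (k ≥ 1, so length ≥ 3) of distinct vertices
HasCycle : Graph → Set
HasCycle G = Σ (Vtx G) λ v → Σ (List (Vtx G)) λ ws → Σ (Vtx G) λ w →
  (1 ≤ length ws) × Unique (v ∷ (ws ∷ʳ w)) × Chain G v (ws ∷ʳ w) × (adj G w v ≡ true)

IsTree : Graph → Set
IsTree G = (1 ≤ n G) × IsSimple G × Connected G × ¬ HasCycle G

degree : (G : Graph) → Vtx G → ℕ
degree G u = sum (map (λ v → if adj G u v then 1 else 0) (allFin (n G)))

IsLeaf : (G : Graph) → Vtx G → Set
IsLeaf G u = degree G u ≡ 1

-- Burning sequences of length m, indexed by Fin m; index i stands for round toℕ i + 1.
-- The neighbourhood associated to x_i is N_{m-i}[x_i], i.e. radius m ∸ (toℕ i + 1).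
radius : (m : ℕ) → Fin m → ℕ
radius m i = m ∸ suc (toℕ i)

IsBurningSeq : (G : Graph) (m : ℕ) → (Fin m → Vtx G) → Set
IsBurningSeq G m x =
  (∀ u → ∃ λ i → Reach G (radius m i) (x i) u) ×
  (∀ i j → toℕ i < toℕ j → DistGe G (x i) (x j) (toℕ j ∸ toℕ i))

Burnable : Graph → ℕ → Set
Burnable G m = Σ ℕ λ k → (k ≤ m) × Σ (Fin k → Vtx G) λ x → IsBurningSeq G k x

HasBurningNumber : Graph → ℕ → Set
HasBurningNumber G m = Burnable G m × (∀ k → k < m → ¬ Burnable G k)

BurnedInRound : (G : Graph) (m : ℕ) → (Fin m → Vtx G) → Vtx G → ℕ → Set
BurnedInRound G m x u r =
  (∃ λ i → Reach G (r ∸ suc (toℕ i)) (x i) u × suc (toℕ i) ≤ r) ×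
  (∀ i l → Reach G l (x i) u → r ≤ suc (toℕ i) + l)

NonOverlapping : (G : Graph) (m : ℕ) → (Fin m → Vtx G) → Set
NonOverlapping G m x = ∀ i j → i ≢ j → ¬ (∃ λ u → Reach G (radius m i) (x i) u × Reach G (radius m j) (x j) u)

-- Subdividing an edge: the new vertex is fromℕ n (the last one); old vertices
-- are embedded by inject₁.
old? : ∀ {k} → Fin (suc k) → Maybe (Fin k)
old? {zero}  _       = nothing
old? {suc k} zero    = just zero
old? {suc k} (suc i) = Maybe.map suc (old? i)

subdivide : (G : Graph) → Vtx G → Vtx G → Graph
subdivide G a b = record { n = suc (n G) ; adj = adj' }
  where
  eq : Vtx G → Vtx G → Bool
  eq u v = ⌊ u ≟ v ⌋
  isEnd : Vtx G → Bool
  isEnd u = eq u a ∨ eq u b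
  isAB : Vtx G → Vtx G → Bool
  isAB u v = (eq u a ∧ eq v b) ∨ (eq u b ∧ eq v a)
  adj' : Fin (suc (n G)) → Fin (suc (n G)) → Bool
  adj' x y with old? x | old? y
  ... | just u  | just v  = adj G u v ∧ not (isAB u v)
  ... | just u  | nothing = isEnd u
  ... | nothing | just v  = isEnd v
  ... | nothing | nothing = false

-- T (with b(T) = m) is maximally m-burnable: inserting a new vertex into any
-- arm / internal path (i.e. subdividing any edge) yields a non-m-burnable tree.
MaximallyBurnable : Graph → ℕ → Set
MaximallyBurnable G m = HasBurningNumber G m ×
  (∀ a b → adj G a b ≡ true → ¬ Burnable (subdivide G a b) m)

-- Any m balls N_{m-1}[c₁], …, N₀[c_m] covering a connected graph can be turned into a
-- burning sequence: scan the sources in order, and whenever c_j is already on fire when it is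
-- lit, move it to an unburnt vertex next to the fire. The result is shorter, or is the cover
-- itself, or has two overlapping neighbourhoods.
--
-- (⇒) If an optimal sequence burns a leaf early, pushing that leaf one step out keeps the
-- balls a cover. If two neighbourhoods overlap, split the vertices into regions by the source
-- whose fire arrives first; some edge between two regions catches fire before round m, and
-- subdividing it keeps every shortest source-to-vertex walk intact. Either way a subdivision is
-- m-burnable.
--
-- (⇐) Collapse the new vertex z of an m-burnable subdivision onto an end e of its edge. The
-- source covering z reaches e, and walking away from it on e's side meets either a leaf strictly
-- inside its ball or a vertex at exactly its radius; the latter was out of its reach in the
-- subdivision, so another ball covers it too. The repaired cover is then shorter than b(T), or
-- an optimal sequence with an overlap or an early leaf.

module Submission where

open import Defs
open import Data.Bool using (Bool; true; false; _∧_; _∨_; not; if_then_else_)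
open import Data.Bool.Properties using (¬-not) renaming (_≟_ to _≟ᵇ_)
open import Data.Empty using (⊥; ⊥-elim)
open import Data.Fin using (Fin; zero; suc; toℕ; fromℕ; fromℕ<; inject₁; inject≤; _≟_)
import Data.Fin.Properties as Finₚ
open import Data.Fin.Properties using (any?; toℕ-injective; toℕ<n; toℕ-fromℕ<; toℕ-inject≤; fromℕ≢inject₁; inject₁-injective)
open import Data.List using (List; []; _∷_; _∷ʳ_; tabulate)
open import Data.List.Membership.Propositional using (_∈_)
open import Data.List.Properties using (map-tabulate)
open import Data.List.Relation.Unary.All using (All; []; _∷_)
open import Data.List.Relation.Unary.AllPairs using ([]; _∷_)
open import Data.List.Relation.Unary.Any using (here; there)
open import Data.List.Relation.Unary.Unique.Propositional using (Unique)
open import Data.Maybe using (just; nothing; fromMaybe)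
open import Data.Nat using (ℕ; zero; suc; _+_; _∸_; _≤_; _<_; z≤n; s≤s; s≤s⁻¹; _≤?_; _<?_) renaming (_≟_ to _≟ℕ_)
open import Data.Nat.ListAction using (sum)
open import Data.Nat.Properties hiding (_≟_)
open import Data.Product using (Σ; ∃; _×_; _,_; proj₁; proj₂)
open import Data.Sum using (_⊎_; inj₁; inj₂; [_,_]′) renaming (map to ⊎-map)
open import Data.Unit using (tt)
open import Data.Vec.Functional using (updateAt)
open import Data.Vec.Functional.Properties using (updateAt-updates; updateAt-minimal)
open import Function using (_∘_; id; const)
open import Function.Bundles using (_⇔_; mk⇔)
open import Relation.Binary.Definitions using (tri<; tri≈; tri>)
open import Relation.Binary.PropositionalEquality using (_≡_; _≢_; refl; sym; trans; cong; cong₂; subst; subst₂)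
open import Relation.Nullary using (¬_; Dec; yes; no; does; map′; ¬?; _×-dec_; _⊎-dec_)
open import Relation.Nullary.Decidable using (⌊_⌋; decidable-stable; dec-true; isYes≗does)

Least : (ℕ → Set) → ℕ → Set
Least P d = P d × (∀ j → P j → d ≤ j)

least-below : {P : ℕ → Set} → (∀ k → Dec (P k)) → ∀ k →
              (∃ λ d → d < k × Least P d) ⊎ (∀ j → j < k → ¬ P j)
least-below P? zero = inj₂ (λ _ ())
least-below P? (suc k) with least-below P? k
... | inj₁ (d , d<k , least-d) = inj₁ (d , m<n⇒m<1+n d<k , least-d)
... | inj₂ none with P? k
...   | yes pk = inj₁ (k , ≤-refl , pk , λ j pj → ≮⇒≥ (λ j<k → none j j<k pj))
...   | no ¬pk = inj₂ λ j j<1+k pj →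
          [ (λ j<k → none j j<k pj) , (λ { refl → ¬pk pj }) ]′ (m<1+n⇒m<n∨m≡n j<1+k)

least : {P : ℕ → Set} → (∀ k → Dec (P k)) → ∀ {k} → P k → ∃ (Least P)
least P? {k} pk with least-below P? (suc k)
... | inj₁ (d , _ , least-d) = d , least-d
... | inj₂ none = ⊥-elim (none k ≤-refl pk)

Symmetric : Graph → Set
Symmetric G = ∀ {u v} → adj G u v ≡ true → adj G v u ≡ true

simple⇒symmetric : ∀ {G} → IsSimple G → Symmetric G
simple⇒symmetric (sym-adj , _) {u} {v} e = trans (sym (sym-adj u v)) e

module Walks (G : Graph) where

  reach-mono : ∀ {k l u v} → k ≤ l → Reach G k u v → Reach G l u v
  reach-mono _ here = here
  reach-mono (s≤s k≤l) (step e r) = step e (reach-mono k≤l r)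

  reach-suc : ∀ {k u v} → Reach G k u v → Reach G (suc k) u v
  reach-suc = reach-mono (n≤1+n _)

  infixr 5 _++_
  _++_ : ∀ {k l u w v} → Reach G k u w → Reach G l w v → Reach G (k + l) u v
  _++_ {k} {l} here r = reach-mono (m≤n+m l k) r
  step e r ++ r′ = step e (r ++ r′)

  reach-snoc : ∀ {k u w v} → Reach G k u w → adj G w v ≡ true → Reach G (suc k) u v
  reach-snoc {k} {u} {v = v} r e = subst (λ l → Reach G l u v) (+-comm k 1) (r ++ step e here)

  reach-zero : ∀ {u v} → Reach G 0 u v → u ≡ v
  reach-zero here = refl

  reach⇒neighbour : ∀ {k u v} → Reach G k u v → u ≢ v → ∃ λ w → adj G u w ≡ true
  reach⇒neighbour here u≢v = ⊥-elim (u≢v refl)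
  reach⇒neighbour (step e _) _ = _ , e

  reach? : ∀ k u v → Dec (Reach G k u v)
  reach? zero u v = map′ (λ { refl → here }) reach-zero (u ≟ v)
  reach? (suc k) u v with u ≟ v
  ... | yes refl = yes here
  ... | no u≢v = map′ (λ (w , e , r) → step e r) first-step
                      (any? λ w → (adj G u w ≟ᵇ true) ×-dec reach? k w v)
    where
    first-step : Reach G (suc k) u v → ∃ λ w → adj G u w ≡ true × Reach G k w v
    first-step here = ⊥-elim (u≢v refl)
    first-step (step e r) = _ , e , r

reach-map : ∀ {G H : Graph} (f : Vtx G → Vtx H) →
            (∀ {u v} → adj G u v ≡ true → f u ≡ f v ⊎ adj H (f u) (f v) ≡ true) →
            ∀ {k u v} → Reach G k u v → Reach H k (f u) (f v)
reach-map f f-adj here = here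
reach-map {H = H} f f-adj (step {k} {v = v} e r) with f-adj e
... | inj₁ same = subst (λ w → Reach H (suc k) w (f v)) (sym same) (Walks.reach-suc H (reach-map f f-adj r))
... | inj₂ e′ = step e′ (reach-map f f-adj r)

module SymmetricWalks (G : Graph) (sym-G : Symmetric G) where
  open Walks G

  reach-sym : ∀ {k u v} → Reach G k u v → Reach G k v u
  reach-sym here = here
  reach-sym (step e r) = reach-snoc (reach-sym r) (sym-G e)

module WalkVertices (G : Graph) where

  vertices : ∀ {k u v} → Reach G k u v → List (Vtx G)
  vertices (here {u = u}) = u ∷ []
  vertices (step {u = u} _ r) = u ∷ vertices r

  vertices-∷ʳ : ∀ {k u v} (r : Reach G k u v) → ∃ λ ws → vertices r ≡ ws ∷ʳ v
  vertices-∷ʳ here = [] , refl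
  vertices-∷ʳ (step {u = u} _ r) with vertices-∷ʳ r
  ... | ws , eq = u ∷ ws , cong (u ∷_) eq

  suffix : ∀ {k u v x} (r : Reach G k u v) → x ∈ vertices r → Reach G k x v
  suffix here (here refl) = here
  suffix (step e r) (here refl) = step e r
  suffix (step _ r) (there x∈r) = Walks.reach-suc G (suffix r x∈r)

  IsShortest : ∀ {k u v} → Reach G k u v → Set
  IsShortest {k} {u} {v} _ = ∀ j → Reach G j u v → k ≤ j

  shortest-unique : ∀ {k u v} (r : Reach G k u v) → IsShortest r → Unique (vertices r)
  shortest-unique here _ = [] ∷ []
  shortest-unique {suc k} {u} (step e r) shortest = all-≢ (vertices r) id ∷ shortest-unique r shortest-r
    where
    shortest-r : IsShortest r
    shortest-r j r′ = s≤s⁻¹ (shortest (suc j) (step e r′))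
    all-≢ : ∀ xs → (∀ {x} → x ∈ xs → x ∈ vertices r) → All (u ≢_) xs
    all-≢ [] _ = []
    all-≢ (x ∷ xs) ⊆r = u≢x ∷ all-≢ xs (⊆r ∘ there)
      where
      u≢x : u ≢ x
      u≢x refl = <-irrefl refl (shortest k (suffix r (⊆r (here refl))))

module Distance (G : Graph) (sym-G : Symmetric G) (conn : Connected G) where
  open Walks G
  open SymmetricWalks G sym-G

  opaque
    shortest : ∀ u v → ∃ (Least λ k → Reach G k u v)
    shortest u v = least (λ k → reach? k u v) (proj₂ (conn u v))

    dist : Vtx G → Vtx G → ℕ
    dist u v = proj₁ (shortest u v)

    dist-reach : ∀ u v → Reach G (dist u v) u v
    dist-reach u v = proj₁ (proj₂ (shortest u v))

    dist-minimal : ∀ {l u v} → Reach G l u v → dist u v ≤ l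
    dist-minimal {l} {u} {v} r = proj₂ (proj₂ (shortest u v)) l r

  dist-self : ∀ u → dist u u ≡ 0
  dist-self u = n≤0⇒n≡0 (dist-minimal {0} {u} {u} here)

  dist≡0⇒≡ : ∀ {u v} → dist u v ≡ 0 → u ≡ v
  dist≡0⇒≡ {u} {v} eq = reach-zero (subst (λ l → Reach G l u v) eq (dist-reach u v))

  dist-adj : ∀ c {u w} → adj G u w ≡ true → dist c w ≤ suc (dist c u)
  dist-adj c {u} e = dist-minimal (reach-snoc (dist-reach c u) e)

  Childless : Vtx G → (Vtx G → Set) → Vtx G → Set
  Childless c S v = ¬ ∃ λ u → adj G v u ≡ true × S u × dist c u ≡ suc (dist c v)

  FarOrLeaf : Vtx G → ℕ → (Vtx G → Set) → Set
  FarOrLeaf c r S = (∃ λ w → S w × dist c w ≡ r) ⊎ (∃ λ w → S w × IsLeaf G w × dist c w < r)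

  outward : ∀ c r {S : Vtx G → Set} → (∀ v → Dec (S v)) → (∀ {v} → S v → Childless c S v → IsLeaf G v) →
            ∀ {v} → S v → dist c v ≤ r → FarOrLeaf c r S
  outward c r {S} S? leafy {v} sv le = go (r ∸ dist c v) sv (m∸n+n≡m le)
    where
    go : ∀ f {v} → S v → f + dist c v ≡ r → FarOrLeaf c r S
    go zero sv eq = inj₁ (_ , sv , eq)
    go (suc f) {v} sv eq with any? (λ u → (adj G v u ≟ᵇ true) ×-dec S? u ×-dec (dist c u ≟ℕ suc (dist c v)))
    ... | yes (u , _ , su , du) = go f su (trans (cong (f +_) du) (trans (+-suc f _) eq))
    ... | no childless = inj₂ (v , sv , leafy sv childless , subst (dist c v <_) eq (s≤s (m≤n+m _ f)))

IsEdge : ∀ {N} → Fin N → Fin N → Fin N → Fin N → Set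
IsEdge a b u v = (u ≡ a × v ≡ b) ⊎ (u ≡ b × v ≡ a)

isEdge? : ∀ {N} (a b u v : Fin N) → Dec (IsEdge a b u v)
isEdge? a b u v = (u ≟ a ×-dec v ≟ b) ⊎-dec (u ≟ b ×-dec v ≟ a)

isEdge-swap : ∀ {N} {a b u v : Fin N} → IsEdge a b u v → IsEdge b a u v
isEdge-swap = [ inj₂ , inj₁ ]′

isEdge-flip : ∀ {N} {a b u v : Fin N} → IsEdge a b u v → IsEdge a b v u
isEdge-flip = [ (λ (p , q) → inj₂ (q , p)) , (λ (p , q) → inj₁ (q , p)) ]′

isEdge⇒adj : ∀ {G} → Symmetric G → ∀ {a b u v} → adj G a b ≡ true → IsEdge a b u v → adj G u v ≡ true
isEdge⇒adj _ eab (inj₁ (refl , refl)) = eab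
isEdge⇒adj sym-G eab (inj₂ (refl , refl)) = sym-G eab

-- Spelled as in `subdivide`, so that its adjacency of old vertices is definitionally this one.
isEdgeᵇ : ∀ {N} → Fin N → Fin N → Fin N → Fin N → Bool
isEdgeᵇ a b u v = (⌊ u ≟ a ⌋ ∧ ⌊ v ≟ b ⌋) ∨ (⌊ u ≟ b ⌋ ∧ ⌊ v ≟ a ⌋)

isEdgeᵇ≡does : ∀ {N} (a b u v : Fin N) → isEdgeᵇ a b u v ≡ does (isEdge? a b u v)
isEdgeᵇ≡does a b u v = cong₂ _∨_ (cong₂ _∧_ (isYes≗does (u ≟ a)) (isYes≗does (v ≟ b)))
                                 (cong₂ _∧_ (isYes≗does (u ≟ b)) (isYes≗does (v ≟ a)))

deleteEdge : (G : Graph) → Vtx G → Vtx G → Graph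
deleteEdge G a b = record { n = n G ; adj = λ u v → adj G u v ∧ not (isEdgeᵇ a b u v) }

∧-not-does⁻ : ∀ {P : Set} {x} (p? : Dec P) → x ∧ not (does p?) ≡ true → x ≡ true × ¬ P
∧-not-does⁻ {x = true} (no ¬p) _ = refl , ¬p

∧-not-does⁺ : ∀ {P : Set} {x} (p? : Dec P) → x ≡ true → ¬ P → x ∧ not (does p?) ≡ true
∧-not-does⁺ (yes p) _ ¬p = ⊥-elim (¬p p)
∧-not-does⁺ (no _) refl _ = refl

module Deletion (G : Graph) (a b : Vtx G) where

  adj⁻ : ∀ {u v} → adj (deleteEdge G a b) u v ≡ true → adj G u v ≡ true × ¬ IsEdge a b u v
  adj⁻ {u} {v} rewrite isEdgeᵇ≡does a b u v = ∧-not-does⁻ (isEdge? a b u v)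

  adj⁺ : ∀ {u v} → adj G u v ≡ true → ¬ IsEdge a b u v → adj (deleteEdge G a b) u v ≡ true
  adj⁺ {u} {v} rewrite isEdgeᵇ≡does a b u v = ∧-not-does⁺ (isEdge? a b u v)

  symmetric : Symmetric G → Symmetric (deleteEdge G a b)
  symmetric sym-G e with adj⁻ e
  ... | e′ , ¬edge = adj⁺ (sym-G e′) (¬edge ∘ isEdge-flip)

  swap : ∀ {k u v} → Reach (deleteEdge G a b) k u v → Reach (deleteEdge G b a) k u v
  swap = reach-map id λ {u} {v} e → inj₂ (subst (λ t → adj G u v ∧ not t ≡ true) (sym (isEdgeᵇ≡does b a u v))
    (∧-not-does⁺ (isEdge? b a u v) (proj₁ (adj⁻ e)) (proj₂ (adj⁻ e) ∘ isEdge-swap)))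

  chain : ∀ {k x u v} (r : Reach (deleteEdge G a b) k u v) → adj G x u ≡ true →
          Chain G x (WalkVertices.vertices (deleteEdge G a b) r)
  chain here e = e , tt
  chain (step e′ r) e = e , chain r (proj₁ (adj⁻ e′))

-- Such a walk never visits b, so it uses no edge at b.
reach-avoiding : ∀ {G b o k x y} → Reach G k x y → (∀ {j} → Reach G j x b → k ≤ j) → y ≢ b →
                 Reach (deleteEdge G b o) k x y
reach-avoiding here _ _ = here
reach-avoiding {G} {b} {o} {suc k} {x} (step {w = w} e r) shortest y≢b =
  step (Deletion.adj⁺ G b o e [ (λ (p , _) → x≢b p) , (λ (_ , q) → w≢b q) ]′) (reach-avoiding r shortest′ y≢b)
  where
  x≢b : x ≢ b
  x≢b refl with shortest {0} here
  ... | ()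
  w≢b : w ≢ b
  w≢b refl with shortest (step e here)
  ... | s≤s k≤0 with n≤0⇒n≡0 k≤0
  ... | refl = y≢b (sym (Walks.reach-zero G r))
  shortest′ : ∀ {j} → Reach G j w b → k ≤ j
  shortest′ r′ = s≤s⁻¹ (shortest (step e r′))

-- A shortest walk from b back to a avoiding the edge ab closes a cycle.
bridge : ∀ {G} → IsTree G → ∀ {a b k} → adj G a b ≡ true → ¬ Reach (deleteEdge G a b) k b a
bridge {G} (_ , (_ , irreflexive) , _ , acyclic) {a} {b} eab r
  with least (λ k → Walks.reach? (deleteEdge G a b) k b a) r
... | _ , r-min , shortest = no-shortest r-min shortest
  where
  open WalkVertices (deleteEdge G a b)
  no-shortest : ∀ {l} (r : Reach (deleteEdge G a b) l b a) → IsShortest r → ⊥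
  no-shortest here _ with trans (sym (irreflexive a)) eab
  ... | ()
  no-shortest (step e here) _ = proj₂ (Deletion.adj⁻ G a b e) (inj₂ (refl , refl))
  no-shortest (step {w = w} e (step e′ r)) shortest with vertices-∷ʳ r
  ... | ws , eq = acyclic (b , w ∷ ws , a , s≤s z≤n , unique , chain , eab)
    where
    unique : Unique (b ∷ ((w ∷ ws) ∷ʳ a))
    unique = subst (λ xs → Unique (b ∷ w ∷ xs)) eq (shortest-unique (step e (step e′ r)) shortest)
    chain : Chain G b ((w ∷ ws) ∷ʳ a)
    chain = subst (λ xs → Chain G b (w ∷ xs)) eq (Deletion.chain G a b (step e′ r) (proj₁ (Deletion.adj⁻ G a b e)))

count : ∀ {N} → (Fin N → Bool) → ℕ
count f = sum (tabulate (λ i → if f i then 1 else 0))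

ExactlyOne : ∀ {N} → (Fin N → Bool) → Set
ExactlyOne {N} f = Σ (Fin N) λ p → f p ≡ true × (∀ w → f w ≡ true → w ≡ p)

count≡0⇒ : ∀ {N} (f : Fin N → Bool) → count f ≡ 0 → ∀ i → f i ≡ false
count≡0⇒ f eq zero with f zero
... | false = refl
count≡0⇒ f eq (suc i) = count≡0⇒ (f ∘ suc) (m+n≡0⇒n≡0 _ eq) i

⇒count≡0 : ∀ {N} (f : Fin N → Bool) → (∀ i → f i ≡ false) → count f ≡ 0
⇒count≡0 {zero} f _ = refl
⇒count≡0 {suc N} f none rewrite none zero = ⇒count≡0 (f ∘ suc) (none ∘ suc)

count≡1⇒ : ∀ {N} (f : Fin N → Bool) → count f ≡ 1 → ExactlyOne f
count≡1⇒ {suc N} f eq with f zero in f0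
... | true = zero , f0 , only-zero
  where
  only-zero : ∀ w → f w ≡ true → w ≡ zero
  only-zero zero _ = refl
  only-zero (suc w) fw with trans (sym (count≡0⇒ (f ∘ suc) (suc-injective eq) w)) fw
  ... | ()
... | false with count≡1⇒ (f ∘ suc) eq
... | p , fp , only-p = suc p , fp , only
  where
  only : ∀ w → f w ≡ true → w ≡ suc p
  only zero fw with trans (sym f0) fw
  ... | ()
  only (suc w) fw = cong suc (only-p w fw)

⇒count≡1 : ∀ {N} (f : Fin N → Bool) → ExactlyOne f → count f ≡ 1
⇒count≡1 f (zero , f0 , only) rewrite f0 =
  cong suc (⇒count≡0 (f ∘ suc) λ i → ¬-not λ fi → Finₚ.0≢1+n (sym (only (suc i) fi)))
⇒count≡1 f (suc p , fp , only) with f zero in f0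
... | true = ⊥-elim (Finₚ.0≢1+n (only zero f0))
... | false = ⇒count≡1 (f ∘ suc) (p , fp , λ w fw → Finₚ.suc-injective (only (suc w) fw))

degree≡count : ∀ G u → degree G u ≡ count (adj G u)
degree≡count G u = cong sum (map-tabulate id (λ v → if adj G u v then 1 else 0))

leaf⇒exactly-one-neighbour : ∀ {G u} → IsLeaf G u → ExactlyOne (adj G u)
leaf⇒exactly-one-neighbour {G} {u} leaf = count≡1⇒ (adj G u) (trans (sym (degree≡count G u)) leaf)

exactly-one-neighbour⇒leaf : ∀ {G u} → ExactlyOne (adj G u) → IsLeaf G u
exactly-one-neighbour⇒leaf {G} {u} one = trans (degree≡count G u) (⇒count≡1 (adj G u) one)

-- Distances in a tree

module Tree (T : Graph) (tree : IsTree T) where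

  symmetric : Symmetric T
  symmetric = simple⇒symmetric (proj₁ (proj₂ tree))

  connected : Connected T
  connected = proj₁ (proj₂ (proj₂ tree))

  open Walks T public
  open SymmetricWalks T symmetric public
  open Distance T symmetric connected public

  adj⇒≢ : ∀ {u v} → adj T u v ≡ true → u ≢ v
  adj⇒≢ {u} e refl with trans (sym (proj₂ (proj₁ (proj₂ tree)) u)) e
  ... | ()

  avoiding : ∀ {c v} w o → dist c v ≤ dist c w → v ≢ w → Reach (deleteEdge T w o) (dist c v) c v
  avoiding {c} {v} _ _ le v≢w = reach-avoiding (dist-reach c v) (λ r → ≤-trans le (dist-minimal r)) v≢w

  edge-separates : ∀ {a b c k l} → adj T a b ≡ true →
                   Reach (deleteEdge T a b) k c a → ¬ Reach (deleteEdge T a b) l c b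
  edge-separates {a} {b} e to-a to-b =
    bridge tree e (reach-symᴰ to-b ++ᴰ to-a)
    where
    open Walks (deleteEdge T a b) using () renaming (_++_ to _++ᴰ_)
    open SymmetricWalks (deleteEdge T a b) (Deletion.symmetric T a b symmetric) using ()
      renaming (reach-sym to reach-symᴰ)

  adj⇒dist≢ : ∀ c {u v} → adj T u v ≡ true → dist c u ≢ dist c v
  adj⇒dist≢ c {u} {v} e eq = edge-separates e
    (Deletion.swap T v u (avoiding v u (≤-reflexive eq) (adj⇒≢ e)))
    (avoiding u v (≤-reflexive (sym eq)) (adj⇒≢ e ∘ sym))

  adj-dist : ∀ c {u v} → adj T u v ≡ true → dist c v ≡ suc (dist c u) ⊎ suc (dist c v) ≡ dist c u
  adj-dist c {u} {v} e with <-cmp (dist c u) (dist c v)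
  ... | tri< lt _ _ = inj₁ (≤-antisym (dist-adj c e) lt)
  ... | tri≈ _ eq _ = ⊥-elim (adj⇒dist≢ c e eq)
  ... | tri> _ _ gt = inj₂ (≤-antisym gt (dist-adj c (symmetric e)))

  unique-parent : ∀ c {v u₁ u₂} → adj T v u₁ ≡ true → adj T v u₂ ≡ true →
                  suc (dist c u₁) ≡ dist c v → suc (dist c u₂) ≡ dist c v → u₁ ≡ u₂
  unique-parent c {v} {u₁} {u₂} e₁ e₂ d₁ d₂ with u₁ ≟ u₂
  ... | yes u₁≡u₂ = u₁≡u₂
  ... | no u₁≢u₂ = ⊥-elim (edge-separates e₁ via-u₂ (avoiding-v u₁ d₁ (adj⇒≢ e₁ ∘ sym)))
    where
    avoiding-v : ∀ u → suc (dist c u) ≡ dist c v → u ≢ v → Reach (deleteEdge T v u₁) (dist c u) c u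
    avoiding-v u d u≢v = avoiding v u₁ (≤-trans (n≤1+n _) (≤-reflexive d)) u≢v
    via-u₂ : Reach (deleteEdge T v u₁) (suc (dist c u₂)) c v
    via-u₂ = Walks.reach-snoc (deleteEdge T v u₁) (avoiding-v u₂ d₂ (adj⇒≢ e₂ ∘ sym))
               (Deletion.adj⁺ T v u₁ (symmetric e₂)
                  [ (λ (p , _) → adj⇒≢ e₂ (sym p)) , (λ (p , _) → u₁≢u₂ (sym p)) ]′)

  OnSide : Vtx T → Vtx T → Vtx T → Set
  OnSide a b v = dist v a < dist v b

  onSide? : ∀ a b v → Dec (OnSide a b v)
  onSide? a b v = dist v a <? dist v b

  onSide-self : ∀ {a b} → adj T a b ≡ true → OnSide a b a
  onSide-self {a} {b} e = subst (_< dist a b) (sym (dist-self a)) (n≢0⇒n>0 (adj⇒≢ e ∘ dist≡0⇒≡))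

  onSide-other : ∀ {a b} → adj T a b ≡ true → ∀ v → ¬ OnSide a b v → OnSide b a v
  onSide-other {a} {b} e v ¬a-side with <-cmp (dist v a) (dist v b)
  ... | tri< lt _ _ = ⊥-elim (¬a-side lt)
  ... | tri≈ _ eq _ = ⊥-elim (adj⇒dist≢ v e eq)
  ... | tri> _ _ gt = gt

  crossing-edge : ∀ {a b x y} → adj T a b ≡ true → adj T x y ≡ true →
                  OnSide a b x → OnSide b a y → x ≡ a × y ≡ b
  crossing-edge {a} {b} {x} {y} eab exy x-near-a y-near-b =
    decidable-stable (x ≟ a ×-dec y ≟ b) λ not-ab → edge-separates eab (via-x not-ab) to-b
    where
    to-b : Reach (deleteEdge T a b) (dist y b) y b
    to-b = avoiding a b (<⇒≤ y-near-b) (adj⇒≢ eab ∘ sym)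
    to-a : Reach (deleteEdge T a b) (dist x a) x a
    to-a = Deletion.swap T b a (avoiding b a (<⇒≤ x-near-a) (adj⇒≢ eab))
    y≢a : y ≢ a
    y≢a refl = n≮0 (subst (dist a b <_) (dist-self a) y-near-b)
    via-x : ¬ (x ≡ a × y ≡ b) → Reach (deleteEdge T a b) (suc (dist x a)) y a
    via-x not-ab = step (Deletion.adj⁺ T a b (symmetric exy)
      [ (λ (y≡a , _) → y≢a y≡a) , (λ (y≡b , x≡a) → not-ab (x≡a , y≡b)) ]′) to-a

  -- With c on the far side of the edge ee′ (or c = e), a childless vertex on e's side has
  -- its parent as its only neighbour (or, for v = c = e, the vertex e′).
  childless⇒leaf : ∀ {e e′ c v} → adj T e e′ ≡ true → (OnSide e e′ c → c ≡ e) →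
                   OnSide e e′ v → Childless c (OnSide e e′) v → IsLeaf T v
  childless⇒leaf {e} {e′} {c} {v} ee′ only-e sv childless = exactly-one-neighbour⇒leaf {T} one
    where
    neighbours : ∀ {u} → adj T v u ≡ true → suc (dist c u) ≡ dist c v ⊎ (v ≡ e × u ≡ e′ × OnSide e e′ c)
    neighbours {u} vu with adj-dist c vu
    ... | inj₂ parent = inj₁ parent
    ... | inj₁ child with onSide? e e′ u
    ...   | yes su = ⊥-elim (childless (u , vu , su , child))
    ...   | no ¬su with crossing-edge ee′ vu sv (onSide-other ee′ u ¬su)
    ...     | refl , refl = inj₂ (refl , refl , subst (dist c v <_) (sym child) ≤-refl)
    one : ExactlyOne (adj T v)
    one with v ≟ c
    ... | no v≢c = let q , vq = reach⇒neighbour (reach-sym (dist-reach c v)) v≢c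
                   in q , vq , λ w vw → unique-parent c vw vq (parent vw) (parent vq)
      where
      parent : ∀ {w} → adj T v w ≡ true → suc (dist c w) ≡ dist c v
      parent vw with neighbours vw
      ... | inj₁ par = par
      ... | inj₂ (v≡e , _ , c-near-e) = ⊥-elim (v≢c (trans v≡e (sym (only-e c-near-e))))
    ... | yes refl with only-e sv
    ...   | refl = e′ , ee′ , only-e′
      where
      only-e′ : ∀ w → adj T v w ≡ true → w ≡ e′
      only-e′ w vw with neighbours vw
      ... | inj₁ par = ⊥-elim (0≢1+n (trans (sym (dist-self v)) (sym par)))
      ... | inj₂ (_ , w≡e′ , _) = w≡e′

old?-inject₁ : ∀ {N} (i : Fin N) → old? (inject₁ i) ≡ just i
old?-inject₁ {suc N} zero = refl
old?-inject₁ {suc N} (suc i) rewrite old?-inject₁ i = refl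

old?-fromℕ : ∀ N → old? (fromℕ N) ≡ nothing
old?-fromℕ zero = refl
old?-fromℕ (suc N) rewrite old?-fromℕ N = refl

old?≡just : ∀ {N} (x : Fin (suc N)) {u} → old? x ≡ just u → x ≡ inject₁ u
old?≡just {suc N} zero refl = refl
old?≡just {suc N} (suc x) eq with old? x in eq′
old?≡just {suc N} (suc x) refl | just _ = cong suc (old?≡just x eq′)

old?≡nothing : ∀ {N} (x : Fin (suc N)) → old? x ≡ nothing → x ≡ fromℕ N
old?≡nothing {zero} zero _ = refl
old?≡nothing {suc N} (suc x) eq with old? x in eq′
... | nothing = cong suc (old?≡nothing x eq′)

does⇒ : ∀ {P : Set} (p? : Dec P) → does p? ≡ true → P
does⇒ (yes p) _ = p

module Subdivision (T : Graph) (a b : Vtx T) where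

  T′ : Graph
  T′ = subdivide T a b

  ι : Vtx T → Vtx T′
  ι = inject₁

  z : Vtx T′
  z = fromℕ (n T)

  open Walks T′ using () renaming (_++_ to _++′_; reach-snoc to reach-snoc′)

  data View : Vtx T′ → Set where
    old : ∀ u → View (ι u)
    new : View z

  view : ∀ x → View x
  view x with old? x in eq
  ... | just u = subst View (sym (old?≡just x eq)) (old u)
  ... | nothing = subst View (sym (old?≡nothing x eq)) new

  IsEnd : Vtx T → Set
  IsEnd u = u ≡ a ⊎ u ≡ b

  isEndᵇ≡does : ∀ u → ⌊ u ≟ a ⌋ ∨ ⌊ u ≟ b ⌋ ≡ does (u ≟ a ⊎-dec u ≟ b)
  isEndᵇ≡does u = cong₂ _∨_ (isYes≗does (u ≟ a)) (isYes≗does (u ≟ b))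

  end⁻ : ∀ {u} → ⌊ u ≟ a ⌋ ∨ ⌊ u ≟ b ⌋ ≡ true → IsEnd u
  end⁻ {u} e = does⇒ (u ≟ a ⊎-dec u ≟ b) (trans (sym (isEndᵇ≡does u)) e)

  end⁺ : ∀ {u} → IsEnd u → ⌊ u ≟ a ⌋ ∨ ⌊ u ≟ b ⌋ ≡ true
  end⁺ {u} end = trans (isEndᵇ≡does u) (dec-true (u ≟ a ⊎-dec u ≟ b) end)

  data Adj : Vtx T′ → Vtx T′ → Set where
    old-old : ∀ {u v} → adj (deleteEdge T a b) u v ≡ true → Adj (ι u) (ι v)
    old-new : ∀ {u} → IsEnd u → Adj (ι u) z
    new-old : ∀ {v} → IsEnd v → Adj z (ι v)

  adj⁻ : ∀ {x y} → adj T′ x y ≡ true → Adj x y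
  adj⁻ {x} {y} e with old? x in ex | old? y in ey
  ... | just u | just v = subst₂ Adj (sym (old?≡just x ex)) (sym (old?≡just y ey)) (old-old e)
  ... | just u | nothing = subst₂ Adj (sym (old?≡just x ex)) (sym (old?≡nothing y ey)) (old-new (end⁻ e))
  ... | nothing | just v = subst₂ Adj (sym (old?≡nothing x ex)) (sym (old?≡just y ey)) (new-old (end⁻ e))

  adj⁺ : ∀ {x y} → Adj x y → adj T′ x y ≡ true
  adj⁺ (old-old {u} {v} e) rewrite old?-inject₁ u | old?-inject₁ v = e
  adj⁺ (old-new {u} end) rewrite old?-inject₁ u | old?-fromℕ (n T) = end⁺ end
  adj⁺ (new-old {v} end) rewrite old?-inject₁ v | old?-fromℕ (n T) = end⁺ end

  isEdge⇒isEnd₁ : ∀ {u v} → IsEdge a b u v → IsEnd u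
  isEdge⇒isEnd₁ = [ inj₁ ∘ proj₁ , inj₂ ∘ proj₁ ]′

  isEdge⇒isEnd₂ : ∀ {u v} → IsEdge a b u v → IsEnd v
  isEdge⇒isEnd₂ = [ inj₂ ∘ proj₂ , inj₁ ∘ proj₂ ]′

  end-end : ∀ {u v} → IsEdge a b u v → Reach T′ 2 (ι u) (ι v)
  end-end edge = step (adj⁺ (old-new (isEdge⇒isEnd₁ edge))) (step (adj⁺ (new-old (isEdge⇒isEnd₂ edge))) here)

  lift : ∀ {k u v} → Reach T k u v → ∃ λ k′ → Reach T′ k′ (ι u) (ι v)
  lift here = 0 , here
  lift (step {u = u} {w = w} e r) with lift r | isEdge? a b u w
  ... | k′ , r′ | yes edge = 2 + k′ , end-end edge ++′ r′
  ... | k′ , r′ | no ¬edge = suc k′ , step (adj⁺ (old-old (Deletion.adj⁺ T a b e ¬edge))) r′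

  T′-connected : Connected T → Connected T′
  T′-connected conn x y with view x | view y
  ... | old u | old v = lift (proj₂ (conn u v))
  ... | old u | new = let k , r = lift (proj₂ (conn u a)) in suc k , reach-snoc′ r (adj⁺ (old-new (inj₁ refl)))
  ... | new | old v = let k , r = lift (proj₂ (conn a v)) in suc k , step (adj⁺ (new-old (inj₁ refl))) r
  ... | new | new = 0 , here

  Crosses : Vtx T → Vtx T → ℕ → Set
  Crosses u v l = Σ (Vtx T) λ a′ → Σ (Vtx T) λ b′ → Σ ℕ λ p → Σ ℕ λ q →
    IsEdge a b a′ b′ × Reach T p u a′ × Reach T q b′ v × suc (p + q) ≤ l

  lift-or-cross : ∀ {l u v} → Reach T l u v → Reach T′ l (ι u) (ι v) ⊎ Crosses u v l
  lift-or-cross here = inj₁ here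
  lift-or-cross {suc l} (step {u = u} {w = w} e r) with isEdge? a b u w
  ... | yes edge = inj₂ (u , w , 0 , l , edge , here , r , ≤-refl)
  ... | no ¬edge with lift-or-cross r
  ...   | inj₁ r′ = inj₁ (step (adj⁺ (old-old (Deletion.adj⁺ T a b e ¬edge))) r′)
  ...   | inj₂ (a′ , b′ , p , q , edge , rp , rq , le) = inj₂ (a′ , b′ , suc p , q , edge , step e rp , rq , s≤s le)

  collapse : Vtx T → Vtx T′ → Vtx T
  collapse e x = fromMaybe e (old? x)

  collapse-ι : ∀ e u → collapse e (ι u) ≡ u
  collapse-ι e u rewrite old?-inject₁ u = refl

  collapse-z : ∀ e → collapse e z ≡ e
  collapse-z e rewrite old?-fromℕ (n T) = refl

  end-adj : Symmetric T → adj T a b ≡ true → ∀ {u e} → IsEnd u → IsEnd e → u ≡ e ⊎ adj T u e ≡ true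
  end-adj _ _ (inj₁ refl) (inj₁ refl) = inj₁ refl
  end-adj _ eab (inj₁ refl) (inj₂ refl) = inj₂ eab
  end-adj sym-T eab (inj₂ refl) (inj₁ refl) = inj₂ (sym-T eab)
  end-adj _ _ (inj₂ refl) (inj₂ refl) = inj₁ refl

  collapse-reach : Symmetric T → adj T a b ≡ true → ∀ {e} → IsEnd e →
                   ∀ {k x y} → Reach T′ k x y → Reach T k (collapse e x) (collapse e y)
  collapse-reach sym-T eab {e} e-end = reach-map (collapse e) (λ e′ → collapse-adj (adj⁻ e′))
    where
    collapse-adj : ∀ {x y} → Adj x y → collapse e x ≡ collapse e y ⊎ adj T (collapse e x) (collapse e y) ≡ true
    collapse-adj (old-old {u} {v} e′) rewrite collapse-ι e u | collapse-ι e v = inj₂ (proj₁ (Deletion.adj⁻ T a b e′))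
    collapse-adj (old-new {u} u-end) rewrite collapse-ι e u | collapse-z e = end-adj sym-T eab u-end e-end
    collapse-adj (new-old {v} v-end) rewrite collapse-z e | collapse-ι e v = ⊎-map sym sym-T (end-adj sym-T eab v-end e-end)

-- From covers to burning sequences

Cover : (G : Graph) (m : ℕ) → (Fin m → Vtx G) → Set
Cover G m c = ∀ v → ∃ λ i → Reach G (radius m i) (c i) v

Overlap : (G : Graph) (m : ℕ) → (Fin m → Vtx G) → Set
Overlap G m x = Σ (Fin m) λ i → Σ (Fin m) λ j → i ≢ j ×
  ∃ λ u → Reach G (radius m i) (x i) u × Reach G (radius m j) (x j) u

ShorterBurningSeq : Graph → ℕ → Set
ShorterBurningSeq G m = Σ ℕ λ k → k < m × Σ (Fin k → Vtx G) (IsBurningSeq G k)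

radius-+ : ∀ m (i : Fin m) → suc (toℕ i) + radius m i ≡ m
radius-+ m i = m+[n∸m]≡n (toℕ<n i)

≤-radius : ∀ {m} (i : Fin m) {l} → suc (toℕ i) + l ≤ m → l ≤ radius m i
≤-radius {m} i {l} le = m+n≤o⇒m≤o∸n l (subst (_≤ m) (+-comm (suc (toℕ i)) l) le)

<-radius⇒ : ∀ {m} (i : Fin m) {l} → l < radius m i → suc (toℕ i) + l < m
<-radius⇒ {m} i lt = subst (suc (toℕ i) + _ <_) (radius-+ m i) (+-monoʳ-< (suc (toℕ i)) lt)

boundary-edge : ∀ {G : Graph} (P : Vtx G → Set) → (∀ v → Dec (P v)) → ∀ {k s t} → Reach G k s t → P s → ¬ P t →
  Σ (Vtx G) λ w₁ → Σ (Vtx G) λ w₂ → Σ ℕ λ p → p < k × Reach G p s w₁ × adj G w₁ w₂ ≡ true × P w₁ × ¬ P w₂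
boundary-edge P P? here ps ¬pt = ⊥-elim (¬pt ps)
boundary-edge P P? (step {w = w} e r) ps ¬pt with P? w
... | yes pw = let w₁ , w₂ , p , p<k , rp , rest = boundary-edge P P? r pw ¬pt in w₁ , w₂ , suc p , s≤s p<k , step e rp , rest
... | no ¬pw = _ , w , 0 , s≤s z≤n , here , e , ps , ¬pw

module CoverToBurning (G : Graph) (conn : Connected G) {m : ℕ} (c : Fin m → Vtx G) (cover : Cover G m c) where
  open Walks G

  Separated : ℕ → (Fin m → Vtx G) → Set
  Separated j x = ∀ i i′ → toℕ i < toℕ i′ → toℕ i′ < j → DistGe G (x i) (x i′) (toℕ i′ ∸ toℕ i)

  OverlapBelow : ℕ → (Fin m → Vtx G) → Set
  OverlapBelow j x = Σ (Fin m) λ i → Σ (Fin m) λ i′ → toℕ i < j × toℕ i′ < j × i ≢ i′ ×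
    ∃ λ u → Reach G (radius m i) (x i) u × Reach G (radius m i′) (x i′) u

  Invariant : ℕ → (Fin m → Vtx G) → Set
  Invariant j x = Separated j x × Cover G m x × ((∀ i → x i ≡ c i) ⊎ OverlapBelow j x)

  Burnt : ℕ → (Fin m → Vtx G) → Vtx G → Set
  Burnt j x v = Σ (Fin m) λ i → toℕ i < j × Reach G (j ∸ suc (toℕ i)) (x i) v

  burnt? : ∀ j x v → Dec (Burnt j x v)
  burnt? j x v = any? λ (i : Fin m) → toℕ i <? j ×-dec reach? (j ∸ suc (toℕ i)) (x i) v

  unburnt⇒distGe : ∀ {j} {x : Fin m → Vtx G} {v} {i : Fin m} → toℕ i < j → ¬ Reach G (j ∸ suc (toℕ i)) (x i) v →
                   DistGe G (x i) v (j ∸ toℕ i)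
  unburnt⇒distGe {j} {i = i} _ ¬r l r = ≮⇒≥ λ l< →
    ¬r (reach-mono (subst (l ≤_) (pred[m∸n]≡m∸[1+n] j (toℕ i)) (<⇒≤pred l<)) r)

  ≢-above : ∀ {i J : Fin m} → toℕ i < toℕ J → i ≢ J
  ≢-above lt refl = <-irrefl refl lt

  extend-separated : ∀ {J x} → Separated (toℕ J) x →
                     (∀ i → toℕ i < toℕ J → DistGe G (x i) (x J) (toℕ J ∸ toℕ i)) → Separated (suc (toℕ J)) x
  extend-separated sep new i i′ lt lt′ with m<1+n⇒m<n∨m≡n lt′
  ... | inj₁ below = sep i i′ lt below
  ... | inj₂ eq rewrite toℕ-injective eq = new i lt

  separated-cong : ∀ {j x x′} → (∀ i → toℕ i < j → x′ i ≡ x i) → Separated j x → Separated j x′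
  separated-cong same sep i i′ lt lt′ rewrite same i (<-trans lt lt′) | same i′ lt′ = sep i i′ lt lt′

  overlapBelow-suc : ∀ {j x} → OverlapBelow j x → OverlapBelow (suc j) x
  overlapBelow-suc (i , i′ , lt , lt′ , rest) = i , i′ , m<n⇒m<1+n lt , m<n⇒m<1+n lt′ , rest

  relay-≤ : ∀ {i J : Fin m} → toℕ i < toℕ J → (toℕ J ∸ suc (toℕ i)) + radius m J ≤ radius m i
  relay-≤ {i} {J} lt = ≤-radius i (begin
    suc (toℕ i) + ((toℕ J ∸ suc (toℕ i)) + radius m J) ≡⟨ +-assoc (suc (toℕ i)) _ _ ⟨
    (suc (toℕ i) + (toℕ J ∸ suc (toℕ i))) + radius m J ≡⟨ cong (_+ radius m J) (m+[n∸m]≡n lt) ⟩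
    toℕ J + radius m J                                  ≤⟨ n≤1+n _ ⟩
    suc (toℕ J) + radius m J                            ≡⟨ radius-+ m J ⟩
    m                                                   ∎)
    where open ≤-Reasoning

  relay-suc-≤ : ∀ {i J : Fin m} → toℕ i < toℕ J → suc (toℕ J ∸ suc (toℕ i)) ≤ radius m i
  relay-suc-≤ {i} {J} lt = ≤-radius i
    (subst (_≤ m) (sym (trans (+-suc (suc (toℕ i)) _) (cong suc (m+[n∸m]≡n lt)))) (toℕ<n J))

  prefix : ∀ {j x} → j < m → Separated j x → (∀ v → Burnt j x v) → ShorterBurningSeq G m
  prefix {j} {x} j<m sep all-burnt = j , j<m , y , cover-y , separated-y
    where
    j≤m = <⇒≤ j<m
    y : Fin j → Vtx G
    y i = x (inject≤ i j≤m)
    cover-y : ∀ v → ∃ λ i → Reach G (radius j i) (y i) v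
    cover-y v with all-burnt v
    ... | i , lt , r = fromℕ< lt , subst₂ (λ k w → Reach G (j ∸ suc k) (x w) v) (sym (toℕ-fromℕ< lt))
                         (sym (toℕ-injective (trans (toℕ-inject≤ (fromℕ< lt) j≤m) (toℕ-fromℕ< lt)))) r
    separated-y : ∀ i i′ → toℕ i < toℕ i′ → DistGe G (y i) (y i′) (toℕ i′ ∸ toℕ i)
    separated-y i i′ lt = subst₂ (λ p q → DistGe G (y i) (y i′) (p ∸ q)) (toℕ-inject≤ i′ j≤m) (toℕ-inject≤ i j≤m)
      (sep (inject≤ i j≤m) (inject≤ i′ j≤m) (subst₂ _<_ (sym (toℕ-inject≤ i j≤m)) (sym (toℕ-inject≤ i′ j≤m)) lt)
           (subst (_< j) (sym (toℕ-inject≤ i′ j≤m)) (toℕ<n i′)))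

  -- Move J to the first unburnt vertex w₂ on a walk out of the burnt region: whatever J
  -- covered, i still covers, and J now overlaps the source that burns the vertex before w₂.
  relight : ∀ {J : Fin m} {x} → Invariant (toℕ J) x → ∀ {i} → toℕ i < toℕ J →
            Reach G (toℕ J ∸ suc (toℕ i)) (x i) (x J) → ∀ {u} → ¬ Burnt (toℕ J) x u → ∃ (Invariant (suc (toℕ J)))
  relight {J} {x} (sep , cov , _) {i} lt r {u} ¬bu
    with boundary-edge (Burnt (toℕ J) x) (burnt? (toℕ J) x) (proj₂ (conn (x i) u)) (i , lt , here) ¬bu
  ... | w₁ , w₂ , _ , _ , _ , e , (i₁ , lt₁ , r₁) , ¬b₂ = x′ , sep′ , cov′ , inj₂ i₁-meets-J
    where
    x′ = updateAt x J (const w₂)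
    x′-J : x′ J ≡ w₂
    x′-J = updateAt-updates J x
    x′-below : ∀ k → toℕ k < toℕ J → x′ k ≡ x k
    x′-below k ltk = updateAt-minimal k J x (≢-above ltk)
    sep′ : Separated (suc (toℕ J)) x′
    sep′ = extend-separated (separated-cong x′-below sep) λ k ltk →
      subst₂ (λ p q → DistGe G p q (toℕ J ∸ toℕ k)) (sym (x′-below k ltk)) (sym x′-J)
        (unburnt⇒distGe {x = x} ltk (λ rk → ¬b₂ (k , ltk , rk)))
    cov′ : Cover G m x′
    cov′ v with cov v
    ... | k , rk with k ≟ J
    ...   | no k≢J = k , subst (λ p → Reach G (radius m k) p v) (sym (updateAt-minimal k J x k≢J)) rk
    ...   | yes refl = i , subst (λ p → Reach G (radius m i) p v) (sym (x′-below i lt)) (reach-mono (relay-≤ lt) (r ++ rk))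
    i₁-meets-J : OverlapBelow (suc (toℕ J)) x′
    i₁-meets-J = i₁ , J , m<n⇒m<1+n lt₁ , ≤-refl , ≢-above lt₁ , w₂ ,
              subst (λ p → Reach G (radius m i₁) p w₂) (sym (x′-below i₁ lt₁)) (reach-mono (relay-suc-≤ lt₁) (reach-snoc r₁ e)) ,
              subst (λ p → Reach G (radius m J) p w₂) (sym x′-J) here

  stage : ∀ J {x} → Invariant (toℕ J) x → ShorterBurningSeq G m ⊎ ∃ (Invariant (suc (toℕ J)))
  stage J {x} inv@(sep , cov , origin) with burnt? (toℕ J) x (x J)
  ... | no unburnt = inj₂ (x , extend-separated sep (λ i lt → unburnt⇒distGe {x = x} lt (λ r → unburnt (i , lt , r))) ,
                           cov , ⊎-map id overlapBelow-suc origin)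
  ... | yes (i , lt , r) with any? (λ v → ¬? (burnt? (toℕ J) x v))
  ...   | yes (u , ¬bu) = inj₂ (relight inv lt r ¬bu)
  ...   | no none = inj₁ (prefix (toℕ<n J) sep (λ v → decidable-stable (burnt? (toℕ J) x v) (λ ¬bv → none (v , ¬bv))))

  run : ∀ j → j ≤ m → ShorterBurningSeq G m ⊎ ∃ (Invariant j)
  run zero _ = inj₂ (c , (λ _ _ _ ()) , cover , inj₁ (λ _ → refl))
  run (suc j) j<m with run j (<⇒≤ j<m)
  ... | inj₁ shorter = inj₁ shorter
  ... | inj₂ (x , inv) = subst (λ k → ShorterBurningSeq G m ⊎ ∃ (Invariant (suc k))) (toℕ-fromℕ< j<m)
                           (stage (fromℕ< j<m) (subst (λ k → Invariant k x) (sym (toℕ-fromℕ< j<m)) inv))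

cover⇒burning : ∀ {G} → Connected G → ∀ {m} {c : Fin m → Vtx G} → Cover G m c →
                ShorterBurningSeq G m ⊎ Σ (Fin m → Vtx G) λ x → IsBurningSeq G m x × (Overlap G m x ⊎ (∀ i → x i ≡ c i))
cover⇒burning {G} conn {m} {c} cover with CoverToBurning.run G conn c cover m ≤-refl
... | inj₁ shorter = inj₁ shorter
... | inj₂ (x , sep , cov , origin) =
  inj₂ (x , (cov , λ i i′ lt → sep i i′ lt (toℕ<n i′)) , [ inj₂ , (λ (i , i′ , _ , _ , rest) → inj₁ (i , i′ , rest)) ]′ origin)

cover⇒burnable : ∀ {G} → Connected G → ∀ {m} {c : Fin m → Vtx G} → Cover G m c → Burnable G m
cover⇒burnable conn cover with cover⇒burning conn cover
... | inj₁ (k , k<m , y , burning) = k , <⇒≤ k<m , y , burning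
... | inj₂ (x , burning , _) = _ , ≤-refl , x , burning

-- Regions of a burning sequence

argmin-last : ∀ {m} (f : Fin m → ℕ) → Fin m →
              Σ (Fin m) λ i → (∀ j → f i ≤ f j) × (∀ j → f j ≡ f i → toℕ j ≤ toℕ i)
argmin-last {suc zero} f _ = zero , (λ { zero → ≤-refl }) , (λ { zero _ → z≤n })
argmin-last {suc (suc m)} f _ with argmin-last (f ∘ suc) zero
... | i , min , last with f (suc i) ≤? f zero
...   | yes le = suc i , (λ { zero → le ; (suc j) → min j }) , (λ { zero _ → z≤n ; (suc j) eq → s≤s (last j eq) })
...   | no ≰ = zero , (λ { zero → ≤-refl ; (suc j) → ≤-trans (<⇒≤ (≰⇒> ≰)) (min j) }) , last₀
  where
  last₀ : ∀ j → f j ≡ f zero → toℕ j ≤ 0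
  last₀ zero _ = z≤n
  last₀ (suc j) eq = ⊥-elim (<-irrefl (sym eq) (<-≤-trans (≰⇒> ≰) (min j)))

-- The region of v is the source whose fire reaches v first, ties going to the later source.
module Regions (G : Graph) (sym-G : Symmetric G) (conn : Connected G) {m} (x : Fin m → Vtx G)
               (burning : IsBurningSeq G m x) where
  open Walks G
  open Distance G sym-G conn

  arrival : Vtx G → Fin m → ℕ
  arrival v i = suc (toℕ i) + dist (x i) v

  first : ∀ v → Σ (Fin m) λ i → (∀ j → arrival v i ≤ arrival v j) × (∀ j → arrival v j ≡ arrival v i → toℕ j ≤ toℕ i)
  first v = argmin-last (arrival v) (proj₁ (proj₁ burning v))

  region : Vtx G → Fin m
  region v = proj₁ (first v)

  burn-time : Vtx G → ℕ
  burn-time v = arrival v (region v)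

  burn-time-≤ : ∀ {v i l} → Reach G l (x i) v → burn-time v ≤ suc (toℕ i) + l
  burn-time-≤ {v} {i} r = ≤-trans (proj₁ (proj₂ (first v)) i) (+-monoʳ-≤ (suc (toℕ i)) (dist-minimal r))

  ≤-region : ∀ {v i l} → Reach G l (x i) v → suc (toℕ i) + l ≤ burn-time v → toℕ i ≤ toℕ (region v)
  ≤-region {v} {i} r le = proj₂ (proj₂ (first v)) i
    (≤-antisym (≤-trans (+-monoʳ-≤ (suc (toℕ i)) (dist-minimal r)) le) (proj₁ (proj₂ (first v)) i))

  burn-time≤m : ∀ v → burn-time v ≤ m
  burn-time≤m v = let i , r = proj₁ burning v in subst (burn-time v ≤_) (radius-+ m i) (burn-time-≤ r)

  -- By separation no fire reaches x s before round suc s, and ties go to the later source.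
  region-source : ∀ s → region (x s) ≡ s
  region-source s = toℕ-injective (≤-antisym region≤s s≤region)
    where
    r = region (x s)
    region≤s : toℕ r ≤ toℕ s
    region≤s = s≤s⁻¹ (≤-trans (m≤m+n (suc (toℕ r)) _) (subst (burn-time (x s) ≤_) (+-identityʳ _) (burn-time-≤ {i = s} here)))
    late : suc (toℕ s) ≤ burn-time (x s)
    late with toℕ r <? toℕ s
    ... | no ≮ = ≤-trans (s≤s (≮⇒≥ ≮)) (m≤m+n _ _)
    ... | yes lt = subst (_≤ burn-time (x s)) (cong suc (m+[n∸m]≡n (<⇒≤ lt)))
          (+-monoʳ-≤ (suc (toℕ r)) (proj₂ burning r s lt _ (dist-reach (x r) (x s))))
    s≤region : toℕ s ≤ toℕ r
    s≤region = ≤-region {i = s} here (subst (_≤ burn-time (x s)) (sym (+-identityʳ _)) late)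

  region-along-shortest : ∀ {v w p q} → Reach G p (x (region v)) w → Reach G q w v →
                          p + q ≤ dist (x (region v)) v → region w ≡ region v
  region-along-shortest {v} {w} {p} {q} rp rq le = toℕ-injective (≤-antisym w≤v v≤w)
    where
    r = region v
    r′ = region w
    via-w : Reach G (dist (x r′) w + q) (x r′) v
    via-w = dist-reach (x r′) w ++ rq
    v≤w : toℕ r ≤ toℕ r′
    v≤w = ≤-region rp (+-cancelʳ-≤ q _ _ (begin
      suc (toℕ r) + p + q       ≡⟨ +-assoc (suc (toℕ r)) p q ⟩
      suc (toℕ r) + (p + q)     ≤⟨ +-monoʳ-≤ (suc (toℕ r)) le ⟩
      burn-time v               ≤⟨ burn-time-≤ via-w ⟩
      suc (toℕ r′) + (dist (x r′) w + q) ≡⟨ +-assoc (suc (toℕ r′)) _ q ⟨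
      burn-time w + q           ∎))
      where open ≤-Reasoning
    w≤v : toℕ r′ ≤ toℕ r
    w≤v = ≤-region via-w (begin
      suc (toℕ r′) + (dist (x r′) w + q) ≡⟨ +-assoc (suc (toℕ r′)) _ q ⟨
      burn-time w + q           ≤⟨ +-monoˡ-≤ q (burn-time-≤ rp) ⟩
      suc (toℕ r) + p + q       ≡⟨ +-assoc (suc (toℕ r)) p q ⟩
      suc (toℕ r) + (p + q)     ≤⟨ +-monoʳ-≤ (suc (toℕ r)) le ⟩
      burn-time v               ∎)
      where open ≤-Reasoning

  region-exit : ∀ s {w} → region w ≢ s → Reach G (radius m s) (x s) w →
    Σ (Vtx G) λ a → Σ (Vtx G) λ b → adj G a b ≡ true × region a ≢ region b × burn-time a < m
  region-exit s w∉s rs with boundary-edge (λ v → region v ≡ s) (λ v → region v ≟ s) rs (region-source s) w∉s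
  ... | a , b , p , p<r , rp , e , a∈s , b∉s = a , b , e , (λ eq → b∉s (trans (sym eq) a∈s)) , early
    where
    open ≤-Reasoning
    early : burn-time a < m
    early = begin-strict
      burn-time a              ≤⟨ burn-time-≤ rp ⟩
      suc (toℕ s) + p          <⟨ +-monoʳ-< (suc (toℕ s)) p<r ⟩
      suc (toℕ s) + radius m s ≡⟨ radius-+ m s ⟩
      m                        ∎

  overlap⇒region-edge : Overlap G m x →
    Σ (Vtx G) λ a → Σ (Vtx G) λ b → adj G a b ≡ true × region a ≢ region b × burn-time a < m
  overlap⇒region-edge (i , j , i≢j , w , ri , rj) with i ≟ region w
  ... | yes refl = region-exit j i≢j rj
  ... | no i≢w = region-exit i (i≢w ∘ sym) ri

  module _ {a b} (eab : adj G a b ≡ true) (regions-differ : region a ≢ region b) where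
    open Subdivision G a b

    -- The walk cannot use the edge ab, whose ends lie in different regions.
    lift-shortest : ∀ v → Reach T′ (dist (x (region v)) v) (ι (x (region v))) (ι v)
    lift-shortest v with lift-or-cross (dist-reach (x (region v)) v)
    ... | inj₁ r′ = r′
    ... | inj₂ (a′ , b′ , p , q , edge , rp , rq , le) = ⊥-elim (regions-differ (ends edge (trans a′∈v (sym b′∈v))))
      where
      e′ = isEdge⇒adj sym-G eab edge
      a′∈v : region a′ ≡ region v
      a′∈v = region-along-shortest rp (step e′ rq) (subst (_≤ dist (x (region v)) v) (sym (+-suc p q)) le)
      b′∈v : region b′ ≡ region v
      b′∈v = region-along-shortest (reach-snoc rp e′) rq le
      ends : ∀ {a′ b′} → IsEdge a b a′ b′ → region a′ ≡ region b′ → region a ≡ region b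
      ends (inj₁ (refl , refl)) eq = eq
      ends (inj₂ (refl , refl)) eq = sym eq

    subdivision-cover : burn-time a < m → Cover T′ m (ι ∘ x)
    subdivision-cover early y with view y
    ... | old v = region v , Walks.reach-mono T′ (≤-radius (region v) (burn-time≤m v)) (lift-shortest v)
    ... | new = region a , Walks.reach-mono T′ (≤-radius (region a) in-time)
                  (Walks.reach-snoc T′ (lift-shortest a) (adj⁺ (old-new (inj₁ refl))))
      where
      in-time : suc (toℕ (region a)) + suc (dist (x (region a)) a) ≤ m
      in-time = subst (_≤ m) (sym (+-suc (suc (toℕ (region a))) _)) early

-- Maximality implies tightness

module LeafSubdivision (G : Graph) (simple : IsSimple G) {u : Vtx G} (leaf : IsLeaf G u) where

  sym-G : Symmetric G
  sym-G = simple⇒symmetric simple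

  neighbour : ExactlyOne (adj G u)
  neighbour = leaf⇒exactly-one-neighbour {G} leaf

  p : Vtx G
  p = proj₁ neighbour

  u-p : adj G u p ≡ true
  u-p = proj₁ (proj₂ neighbour)

  only-p : ∀ w → adj G u w ≡ true → w ≡ p
  only-p = proj₂ (proj₂ neighbour)

  open Subdivision G p u

  φ : Vtx G → Vtx T′
  φ v with v ≟ u
  ... | yes _ = z
  ... | no _ = ι v

  φ-u : φ u ≡ z
  φ-u with u ≟ u
  ... | yes _ = refl
  ... | no u≢u = ⊥-elim (u≢u refl)

  φ-old : ∀ {v} → v ≢ u → φ v ≡ ι v
  φ-old {v} v≢u with v ≟ u
  ... | yes v≡u = ⊥-elim (v≢u v≡u)
  ... | no _ = refl

  φ-adj : ∀ {v w} → adj G v w ≡ true → adj T′ (φ v) (φ w) ≡ true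
  φ-adj {v} {w} e with v ≟ u | w ≟ u
  ... | yes refl | yes refl with trans (sym (proj₂ simple u)) e
  ...   | ()
  φ-adj {v} {w} e | yes refl | no _ = adj⁺ (new-old (inj₁ (only-p w e)))
  φ-adj {v} {w} e | no _ | yes refl = adj⁺ (old-new (inj₁ (only-p v (sym-G e))))
  φ-adj {v} {w} e | no v≢u | no w≢u = adj⁺ (old-old (Deletion.adj⁺ G p u e [ (λ (_ , w≡u) → w≢u w≡u) , (λ (v≡u , _) → v≢u v≡u) ]′))

  φ-reach : ∀ {k v w} → Reach G k v w → Reach T′ k (φ v) (φ w)
  φ-reach = reach-map φ (inj₂ ∘ φ-adj)

  early-leaf-cover : ∀ {m x} → Cover G m x → ∀ {i l} → Reach G l (x i) u → suc (toℕ i) + l < m → Cover T′ m (φ ∘ x)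
  early-leaf-cover {m} {x} cover {i} {l} r early y with view y
  ... | new = let k , rk = cover u in k , subst (Reach T′ (radius m k) (φ (x k))) φ-u (φ-reach rk)
  ... | old v with v ≟ u
  ...   | yes refl = i , Walks.reach-mono T′ (≤-radius i (subst (_≤ m) (sym (+-suc (suc (toℕ i)) l)) early))
                           (Walks.reach-snoc T′ (subst (Reach T′ l (φ (x i))) φ-u (φ-reach r)) (adj⁺ (new-old (inj₂ refl))))
  ...   | no v≢u = let k , rk = cover v in k , subst (Reach T′ (radius m k) (φ (x k))) (φ-old v≢u) (φ-reach rk)

SubdivisionsUnburnable : Graph → ℕ → Set
SubdivisionsUnburnable G m = ∀ a b → adj G a b ≡ true → ¬ Burnable (subdivide G a b) m

leaves-burn-last : ∀ {G} → IsSimple G → Connected G → ∀ {m} → SubdivisionsUnburnable G m →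
                   ∀ {x} → IsBurningSeq G m x → ∀ u → IsLeaf G u → BurnedInRound G m x u m
leaves-burn-last {G} simple conn {m} unburnable {x} (cover , _) u leaf = covered , not-earlier
  where
  open LeafSubdivision G simple leaf
  covered : ∃ λ i → Reach G (m ∸ suc (toℕ i)) (x i) u × suc (toℕ i) ≤ m
  covered = let i , r = cover u in i , r , toℕ<n i
  not-earlier : ∀ i l → Reach G l (x i) u → m ≤ suc (toℕ i) + l
  not-earlier i l r = ≮⇒≥ λ early → unburnable p u (sym-G u-p)
    (cover⇒burnable (Subdivision.T′-connected G p u conn) (early-leaf-cover cover r early))

non-overlapping : ∀ {G} → IsSimple G → Connected G → ∀ {m} → SubdivisionsUnburnable G m →
                  ∀ {x} → IsBurningSeq G m x → NonOverlapping G m x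
non-overlapping {G} simple conn unburnable {x} burning i j i≢j (w , ri , rj) =
  let a , b , e , regions-differ , early = overlap⇒region-edge (i , j , i≢j , w , ri , rj)
  in unburnable a b e (cover⇒burnable (Subdivision.T′-connected G a b conn) (subdivision-cover e regions-differ early))
  where open Regions G (simple⇒symmetric simple) conn x burning

-- Tightness implies maximality

Tight : (G : Graph) (m : ℕ) → (Fin m → Vtx G) → Set
Tight G m x = ((u : Vtx G) → IsLeaf G u → BurnedInRound G m x u m) × NonOverlapping G m x

EarlyLeaf : (G : Graph) (m : ℕ) → (Fin m → Vtx G) → Set
EarlyLeaf G m c = Σ (Vtx G) λ w → Σ (Fin m) λ i → Σ ℕ λ l → IsLeaf G w × Reach G l (c i) w × suc (toℕ i) + l < m

Imperfect : (G : Graph) (m : ℕ) → (Fin m → Vtx G) → Set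
Imperfect G m c = Overlap G m c ⊎ EarlyLeaf G m c

imperfect-cong : ∀ {G m} {x c : Fin m → Vtx G} → (∀ i → x i ≡ c i) → Imperfect G m c → Imperfect G m x
imperfect-cong {G} {m} x≗c (inj₁ (i , j , i≢j , w , ri , rj)) = inj₁ (i , j , i≢j , w ,
  subst (λ s → Reach G (radius m i) s w) (sym (x≗c i)) ri , subst (λ s → Reach G (radius m j) s w) (sym (x≗c j)) rj)
imperfect-cong {G} x≗c (inj₂ (w , i , l , leaf , r , early)) =
  inj₂ (w , i , l , leaf , subst (λ s → Reach G l s w) (sym (x≗c i)) r , early)

tight⇒¬imperfect : ∀ {G m x} → Tight G m x → ¬ Imperfect G m x
tight⇒¬imperfect (_ , non-overlapping) (inj₁ (i , j , i≢j , rest)) = non-overlapping i j i≢j rest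
tight⇒¬imperfect (leaves-last , _) (inj₂ (w , i , l , leaf , r , early)) = <⇒≱ early (proj₂ (leaves-last w leaf) i l r)

module SubdividedTree (T : Graph) (tree : IsTree T) (a b : Vtx T) (eab : adj T a b ≡ true) where
  open Tree T tree
  open Subdivision T a b

  collapse-cover : ∀ {e} → IsEnd e → ∀ {m y} → Cover T′ m y → Cover T m (collapse e ∘ y)
  collapse-cover {e} end {m} {y} cover v = let i , r = cover (ι v) in
    i , subst (Reach T (radius m i) (collapse e (y i))) (collapse-ι e v) (collapse-reach symmetric eab end r)

  Outside : Vtx T → Vtx T → Vtx T′ → Set
  Outside e e′ x = ∀ u → x ≡ ι u → ¬ OnSide e e′ u

  z-outside : ∀ {e e′} → Outside e e′ z
  z-outside _ eq _ = fromℕ≢inject₁ eq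

  outside-ι : ∀ {e e′ u} → ¬ OnSide e e′ u → Outside e e′ (ι u)
  outside-ι ¬near u′ eq = subst (λ t → ¬ OnSide _ _ t) (inject₁-injective eq) ¬near

  ¬onSide-far-end : ∀ {e e′} → IsEdge a b e e′ → ¬ OnSide e e′ e′
  ¬onSide-far-end E near-e = <-asym near-e (onSide-self (symmetric (isEdge⇒adj symmetric eab E)))

  Entry : Vtx T → Vtx T′ → Vtx T → ℕ → Set
  Entry e x v l = Σ ℕ λ p → Σ ℕ λ q → Reach T′ p x z × Reach T′ q (ι e) (ι v) × suc (p + q) ≤ l

  entry-step : ∀ {e x w v l} → adj T′ x w ≡ true → Entry e w v l → Entry e x v (suc l)
  entry-step s (p , q , rp , rq , le) = suc p , q , step s rp , rq , s≤s le

  -- In T the edge ee′ is the only way into e's side; in T′ that edge runs through z.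
  entry : ∀ {e e′} → IsEdge a b e e′ → ∀ {l x v} → Reach T′ l x (ι v) → OnSide e e′ v → Outside e e′ x → Entry e x v l
  entry E here near out = ⊥-elim (out _ refl near)
  entry {e} {e′} E (step s r) near out with adj⁻ s
  ... | old-old {u} {w} uw with onSide? e e′ w
  ...   | no ¬near-w = entry-step s (entry E r near (outside-ι ¬near-w))
  ...   | yes near-w with Deletion.adj⁻ T a b uw
  ...     | uw′ , ¬edge with crossing-edge (symmetric (isEdge⇒adj symmetric eab E)) uw′
                               (onSide-other (isEdge⇒adj symmetric eab E) u (out u refl)) near-w
  ...       | refl , refl = ⊥-elim (¬edge (isEdge-flip E))
  entry E (step s r) near out | old-new _ = entry-step s (entry E r near z-outside)
  entry E (step s r) near out | new-old end with E | end
  ... | inj₁ (refl , refl) | inj₁ refl = 0 , _ , here , r , ≤-refl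
  ... | inj₂ (refl , refl) | inj₂ refl = 0 , _ , here , r , ≤-refl
  ... | inj₁ (refl , refl) | inj₂ refl = entry-step s (entry E r near (outside-ι (¬onSide-far-end E)))
  ... | inj₂ (refl , refl) | inj₁ refl = entry-step s (entry E r near (outside-ι (¬onSide-far-end E)))

  entry-bound : ∀ {e e′} → IsEdge a b e e′ → ∀ {l x v} → Reach T′ l x (ι v) → OnSide e e′ v → Outside e e′ x →
                dist (collapse e x) v < l
  entry-bound {e} E {x = x} {v} r near out with entry E r near out
  ... | p , q , rp , rq , le = <-≤-trans (s≤s (dist-minimal (to-e ++ from-e))) le
    where
    end = isEdge⇒isEnd₁ E
    to-e : Reach T p (collapse e x) e
    to-e = subst (Reach T p (collapse e x)) (collapse-z e) (collapse-reach symmetric eab end rp)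
    from-e : Reach T q e v
    from-e = subst₂ (Reach T q) (collapse-ι e e) (collapse-ι e v) (collapse-reach symmetric eab end rq)

  module _ {m} {y : Fin m → Vtx T′} (cover : Cover T′ m y) where

    imperfection : ∀ {e e′} → IsEdge a b e e′ → ∀ s {x} → y s ≡ x → Reach T′ (radius m s) x z → Outside e e′ x →
                   (OnSide e e′ (collapse e x) → collapse e x ≡ e) → Imperfect T m (collapse e ∘ y)
    imperfection {e} {e′} E s {x} ys rz out only-e = far-or-leaf
      (outward c (radius m s) (onSide? e e′) (childless⇒leaf ee′ only-e) (onSide-self ee′) (dist-minimal to-e))
      where
      ee′ = isEdge⇒adj symmetric eab E
      end = isEdge⇒isEnd₁ E
      c = collapse e x
      c≡ : collapse e (y s) ≡ c
      c≡ = cong (collapse e) ys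
      to-e : Reach T (radius m s) c e
      to-e = subst (Reach T (radius m s) c) (collapse-z e) (collapse-reach symmetric eab end rz)
      far-or-leaf : FarOrLeaf c (radius m s) (OnSide e e′) → Imperfect T m (collapse e ∘ y)
      far-or-leaf (inj₂ (w , _ , leaf , near)) =
        inj₂ (w , s , dist c w , leaf , subst (λ t → Reach T (dist c w) t w) (sym c≡) (dist-reach c w) , <-radius⇒ s near)
      -- In T′ the vertex w lies beyond the ball of s.
      far-or-leaf (inj₁ (w , near-w , dw)) with cover (ι w)
      ... | j , rj with j ≟ s
      ...   | yes refl = ⊥-elim (<-irrefl dw (entry-bound E (subst (λ t → Reach T′ (radius m j) t (ι w)) ys rj) near-w out))
      ...   | no j≢s = inj₁ (s , j , j≢s ∘ sym , w ,
                         subst₂ (λ t k → Reach T k t w) (sym c≡) dw (dist-reach c w) ,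
                         subst (Reach T (radius m j) (collapse e (y j))) (collapse-ι e w) (collapse-reach symmetric eab end rj))

    imperfect-collapse : Σ (Vtx T) λ e → IsEnd e × Imperfect T m (collapse e ∘ y)
    imperfect-collapse = let s , rz = cover z in choose s (view (y s)) refl rz
      where
      choose : ∀ s {x} → View x → y s ≡ x → Reach T′ (radius m s) x z → Σ (Vtx T) λ e → IsEnd e × Imperfect T m (collapse e ∘ y)
      choose s new ys rz = a , inj₁ refl , imperfection (inj₁ (refl , refl)) s ys rz z-outside (λ _ → collapse-z a)
      choose s (old c₀) ys rz with onSide? a b c₀
      ... | yes near-a = b , inj₂ refl , imperfection (inj₂ (refl , refl)) s ys rz (outside-ι (<-asym near-a))
                           (λ near-b → ⊥-elim (<-asym near-a (subst (OnSide b a) (collapse-ι b c₀) near-b)))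
      ... | no ¬near-a = a , inj₁ refl , imperfection (inj₁ (refl , refl)) s ys rz (outside-ι ¬near-a)
                           (λ near-a → ⊥-elim (¬near-a (subst (OnSide a b) (collapse-ι a c₀) near-a)))

  subdivision-unburnable : ∀ {m} → HasBurningNumber T m → (∀ x → IsBurningSeq T m x → Tight T m x) → ¬ Burnable T′ m
  subdivision-unburnable (_ , minimal) tight (k , k≤m , y , cover′ , _) with m≤n⇒m<n∨m≡n k≤m
  ... | inj₁ k<m = minimal k k<m (cover⇒burnable connected (collapse-cover (inj₁ refl) cover′))
  ... | inj₂ refl with imperfect-collapse cover′
  ...   | e , end , imperfect with cover⇒burning connected (collapse-cover end cover′)
  ...     | inj₁ (k′ , k′<m , y′ , burning′) = minimal k′ k′<m (k′ , ≤-refl , y′ , burning′)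
  ...     | inj₂ (x , burning , inj₁ overlapping) = tight⇒¬imperfect (tight x burning) (inj₁ overlapping)
  ...     | inj₂ (x , burning , inj₂ x≗c) = tight⇒¬imperfect (tight x burning) (imperfect-cong x≗c imperfect)

maximal⇒tight : ∀ {T} → IsTree T → ∀ {m} → MaximallyBurnable T m → ∀ x → IsBurningSeq T m x → Tight T m x
maximal⇒tight (_ , simple , conn , _) (_ , unburnable) _ burning =
  leaves-burn-last simple conn unburnable burning , non-overlapping simple conn unburnable burning

tight⇒maximal : ∀ {T} → IsTree T → ∀ {m} → HasBurningNumber T m →
                (∀ x → IsBurningSeq T m x → Tight T m x) → MaximallyBurnable T m
tight⇒maximal {T} tree b-T tight = b-T , λ a b eab → SubdividedTree.subdivision-unburnable T tree a b eab b-T tight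

corollary2p4 : (T : Graph) → IsTree T → (m : ℕ) → HasBurningNumber T m →
    (MaximallyBurnable T m ⇔
      ((x : Fin m → Vtx T) → IsBurningSeq T m x →
        ((u : Vtx T) → IsLeaf T u → BurnedInRound T m x u m) × NonOverlapping T m x))
corollary2p4 T tree m b-T = mk⇔ (maximal⇒tight tree) (tight⇒maximal tree b-T)
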